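{- Let $\mathcal M$ be a $q$-matroid of rank $2$ on $\mathbb F_2^4$ (so $q=2$) having exactly $34$ bases (equivalently, $\mathcal M$ is an almost uniform $q$-matroid $\mathcal{AU}_{2,4}(2,X)$ for some $2$-dimensional subspace $X$). Then for every $m\in\{2,3\}$, $\mathcal M$ is not purely $m$-multilinear.
   Context: Let $E=\mathbb F_2^4$, $\mathcal L(E)$ its set of subspaces, $U^\perp$ orthogonal complement under the standard dot product. A $q$-matroid on $E$ is $(\mathcal L(E),\rho)$ with $\rho:\mathcal L(E)\to\mathbb Z$ satisfying $0\le\rho(A)\le\dim A$, monotonicity, and submodularity; its rank is $\rho(E)$, and its bases are the subspaces $B$ with $\rho(B)=\dim B=\rho(E)$. $\mathcal{AU}_{2,4}(2,X)$ has rank function $\rho(V)=1$ if $V=X$ and $\rho(V)=\min\{\dim V,2\}$ otherwise. For an $\mathbb F_2$-linear $\mathcal C\subseteq\mathbb F_2^{4\times m}$ of dimension $k'$, $\rho_{\mathcal C}(U)=(k'-\dim\mathcal C(U^\perp))/m$ with $\mathcal C(W)=\{M\in\mathcal C:\operatorname{colsp}(M)\subseteq W\}$; $\mathcal M$ is $\mathbb F_2^{4\times m}$-representable if its rank function is $\rho_{\mathcal C}$ for some such $\mathcal C$. For $x\in\mathbb F_{2^m}^4$, $\operatorname{supp}(x)$ is the column space of the $4\times m$ binary matrix expanding the coordinates of $x$ in a fixed $\mathbb F_2$-basis of $\mathbb F_{2^m}$; $\mathcal M$ is $\mathbb F_{2^m}$-representable if its rank function is $W\mapsto K-\dim_{\mathbb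 F_{2^m}}\{x\in\mathcal C:\operatorname{supp}(x)\subseteq W^\perp\}$ for some $\mathbb F_{2^m}$-linear $\mathcal C\subseteq\mathbb F_{2^m}^4$ of dimension $K$. For $m>1$, $\mathcal M$ is purely $m$-multilinear if it is $\mathbb F_2^{4\times m}$-representable but not $\mathbb F_{2^m}$-representable. -}

module Defs where

open import Data.Bool using (Bool; true; false; _∧_; _∨_; not; _xor_; if_then_else_; T)
open import Data.Nat using (ℕ; zero; suc; _/_)
open import Data.Nat.Logarithm using (⌊log₂_⌋)
open import Data.Integer as ℤ using (ℤ; +_)
open import Data.List as L using (List; []; _∷_; _++_)
open import Data.Bool.ListAction using (all; any)
open import Data.Vec as V using (Vec; []; _∷_; zipWith; replicate; transpose; init; last)
open import Data.Fin using (Fin)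
open import Data.Product using (Σ; _×_; _,_; proj₁)
open import Relation.Binary.PropositionalEquality using (_≡_)
open import Relation.Nullary using (¬_)
open import Function.Bundles using (_↔_)

-- Vectors over F₂ (F₂ = Bool, addition = xor, multiplication = ∧)

V₂ : ℕ → Set
V₂ n = Vec Bool n

_⊕_ : ∀ {n} → V₂ n → V₂ n → V₂ n
_⊕_ = zipWith _xor_

0v : ∀ {n} → V₂ n
0v = replicate _ false

eqV : ∀ {n} → V₂ n → V₂ n → Bool
eqV [] [] = true
eqV (a ∷ as) (b ∷ bs) = not (a xor b) ∧ eqV as bs

dot : ∀ {n} → V₂ n → V₂ n → Bool
dot [] [] = false
dot (a ∷ as) (b ∷ bs) = (a ∧ b) xor dot as bs

allVecsOf : {A : Set} → List A → (n : ℕ) → List (Vec A n)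
allVecsOf xs zero = [] ∷ []
allVecsOf xs (suc n) = L.concatMap (λ x → L.map (x ∷_) (allVecsOf xs n)) xs

allV : (n : ℕ) → List (V₂ n)
allV n = allVecsOf (false ∷ true ∷ []) n

count : {A : Set} → List A → (A → Bool) → ℕ
count xs P = L.length (L.filter (λ x → T? (P x)) xs)
  where
  open import Relation.Nullary.Decidable using (Dec)
  open import Data.Bool.Properties using (T?)

isLinear : {A : Set} → List A → A → (A → A → A) → (A → Bool) → Bool
isLinear xs z _+_ P =
  P z ∧ all (λ u → all (λ v → not (P u ∧ P v) ∨ P (u + v)) xs) xs

-- F₂-dimension of a (finite) F₂-linear subspace: |S| = 2^dim
dim₂ : {A : Set} → List A → (A → Bool) → ℕ
dim₂ xs P = ⌊log₂ count xs P ⌋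

-- Subsets of F₂ⁿ with a canonical representation (binary trie), so
-- that equal subsets are equal as values.

Tree : ℕ → Set
Tree zero = Bool
Tree (suc n) = Tree n × Tree n

mem : ∀ {n} → Tree n → V₂ n → Bool
mem {zero} b [] = b
mem {suc n} (t₀ , t₁) (false ∷ v) = mem t₀ v
mem {suc n} (t₀ , t₁) (true ∷ v) = mem t₁ v

toTree : ∀ {n} → (V₂ n → Bool) → Tree n
toTree {zero} P = P []
toTree {suc n} P = toTree (λ v → P (false ∷ v)) , toTree (λ v → P (true ∷ v))

E₄ : List (V₂ 4)
E₄ = allV 4

isSubspace : (V₂ 4 → Bool) → Bool
isSubspace P = isLinear E₄ 0v _⊕_ P

record Subspace : Set where
  constructor sub
  field
    carrier : Tree 4
    linear  : T (isSubspace (mem carrier))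
open Subspace public

_∈ˢ_ : V₂ 4 → Subspace → Bool
v ∈ˢ U = mem (carrier U) v

dim : Subspace → ℕ
dim U = dim₂ E₄ (mem (carrier U))

Eˢ : Subspace
Eˢ = sub (toTree (λ _ → true)) _

_⊆ᵖ_ : (V₂ 4 → Bool) → (V₂ 4 → Bool) → Bool
P ⊆ᵖ Q = all (λ v → not (P v) ∨ Q v) E₄

sumP : Subspace → Subspace → V₂ 4 → Bool
sumP A B v = any (λ u → (u ∈ˢ A) ∧ ((u ⊕ v) ∈ˢ B)) E₄

interP : Subspace → Subspace → V₂ 4 → Bool
interP A B v = (v ∈ˢ A) ∧ (v ∈ˢ B)

perpP : (V₂ 4 → Bool) → V₂ 4 → Bool
perpP U v = all (λ u → not (U u) ∨ not (dot u v)) E₄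

record QMatroid : Set where
  field
    ρ : Subspace → ℤ
    ρ-nonneg : ∀ A → + 0 ℤ.≤ ρ A
    ρ-≤dim   : ∀ A → ρ A ℤ.≤ + dim A
    ρ-mono   : ∀ A B → T (mem (carrier A) ⊆ᵖ mem (carrier B)) → ρ A ℤ.≤ ρ B
    ρ-submod : ∀ A B S I → carrier S ≡ toTree (sumP A B)
             → carrier I ≡ toTree (interP A B)
             → (ρ S ℤ.+ ρ I) ℤ.≤ (ρ A ℤ.+ ρ B)
open QMatroid public

rank : QMatroid → ℤ
rank M = ρ M Eˢ

IsBasis : QMatroid → Subspace → Set
IsBasis M B = (ρ M B ≡ + dim B) × (ρ M B ≡ rank M)

Basis : QMatroid → Set
Basis M = Σ Subspace (IsBasis M)

lincomb : ∀ {m} → V₂ m → Vec (V₂ 4) m → V₂ 4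
lincomb [] [] = 0v
lincomb (c ∷ cs) (col ∷ cols) =
  (if c then col else 0v) ⊕ lincomb cs cols

spanP : ∀ {m} → Vec (V₂ 4) m → V₂ 4 → Bool
spanP {m} cols v = any (λ c → eqV (lincomb c cols) v) (allV m)

-- F₂^{4×m}-representability (matrices stored as their m columns)

Mat : ℕ → Set
Mat m = Vec (V₂ 4) m

allMats : (m : ℕ) → List (Mat m)
allMats m = allVecsOf E₄ m

colsp : ∀ {m} → Mat m → V₂ 4 → Bool
colsp M = spanP M

restrictMat : ∀ {m} → (Mat m → Bool) → (V₂ 4 → Bool) → Mat m → Bool
restrictMat C W M = C M ∧ (colsp M ⊆ᵖ W)

-- ρ_𝒞(U) = (k' − dim 𝒞(U^⊥)) / m, stated as m·ρ(U) = k' − dim 𝒞(U^⊥)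
MatrixRepresentable : (m : ℕ) → (Subspace → ℤ) → Set
MatrixRepresentable m ρ' =
  Σ (Mat m → Bool) λ C →
    T (isLinear (allMats m) (replicate m 0v) (zipWith _⊕_) C) ×
    (∀ U → (+ m) ℤ.* ρ' U ≡
             + dim₂ (allMats m) C ℤ.-
             + dim₂ (allMats m) (restrictMat C (perpP (mem (carrier U)))))

-- The field F_{2^m} = F₂[x]/(x^m + x + 1), elements written in the
-- polynomial F₂-basis 1, x, …, x^{m-1} (irreducible for m = 2, 3).

-- low-order coefficients of the modulus: x^m = 1 + x
modulus : (m : ℕ) → V₂ m
modulus (suc (suc k)) = true ∷ true ∷ replicate k false
modulus m = 0v

xtimes : ∀ {m} → V₂ m → V₂ m → V₂ m
xtimes {zero} p a = []
xtimes {suc k} p a = (false ∷ init a) ⊕ (if last a then p else 0v)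

mulF : ∀ {m} → V₂ m → V₂ m → V₂ m
mulF {m} a b = go b a
  where
  go : ∀ {j} → Vec Bool j → V₂ m → V₂ m
  go [] a' = 0v
  go (bi ∷ bs) a' = (if bi then a' else 0v) ⊕ go bs (xtimes (modulus m) a')

FVec : ℕ → Set
FVec m = Vec (V₂ m) 4

allFVecs : (m : ℕ) → List (FVec m)
allFVecs m = allVecsOf (allV m) 4

addF : ∀ {m} → FVec m → FVec m → FVec m
addF = zipWith _⊕_

scaleF : ∀ {m} → V₂ m → FVec m → FVec m
scaleF a x = V.map (mulF a) x

isFLinear : (m : ℕ) → (FVec m → Bool) → Bool
isFLinear m C =
  isLinear (allFVecs m) (replicate 4 0v) addF C ∧
  all (λ a → all (λ x → not (C x) ∨ C (scaleF a x)) (allFVecs m)) (allV m)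

-- supp(x) = column space of the 4×m binary expansion matrix of x
supp : ∀ {m} → FVec m → V₂ 4 → Bool
supp x = colsp (transpose x)

-- dimension over F_{2^m} of an F_{2^m}-subspace: |S| = 2^{m·dim}
dimF : (m : ℕ) → (FVec m → Bool) → ℕ
dimF zero C = 0
dimF (suc k) C = dim₂ (allFVecs (suc k)) C / suc k

restrictF : ∀ {m} → (FVec m → Bool) → (V₂ 4 → Bool) → FVec m → Bool
restrictF C W x = C x ∧ (supp x ⊆ᵖ W)

FieldRepresentable : (m : ℕ) → (Subspace → ℤ) → Set
FieldRepresentable m ρ' =
  Σ (FVec m → Bool) λ C →
    T (isFLinear m C) ×
    (∀ W → ρ' W ≡ + dimF m C ℤ.- + dimF m (restrictF C (perpP (mem (carrier W)))))

PurelyMultilinear : (m : ℕ) → QMatroid → Set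
PurelyMultilinear m M =
  MatrixRepresentable m (ρ M) × ¬ FieldRepresentable m (ρ M)

{-# OPTIONS --safe #-}
module Submission where

-- F₂⁴ has exactly 35 planes (2-dimensional subspaces), so a q-matroid of rank 2
-- with 34 bases has at most one plane P₀ of rank below 2.  For u ∉ P₀ and any
-- other nonzero v, the plane ⟨u⟩ + ⟨v⟩ has rank 2, and submodularity forces the
-- line ⟨u⟩ to have rank 1.  If a code 𝒞 ⊆ F₂^{4×m} represented the q-matroid,
-- then dim 𝒞 = 2m, each 𝒞(⟨u⟩^⊥) with u ∉ P₀ would have dimension m, and for
-- distinct u, v ∉ P₀ we would get 𝒞(⟨u⟩^⊥) ∩ 𝒞(⟨v⟩^⊥) = 𝒞((⟨u⟩ + ⟨v⟩)^⊥) = 0.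
-- The twelve vectors outside P₀ thus give twelve m-dimensional subspaces of 𝒞
-- meeting pairwise in 0, so 1 + 12 (2^m − 1) ≤ 2^{2m}, which fails for m = 2, 3:
-- the q-matroid is not even F₂^{4×m}-representable.

open import Axiom.UniquenessOfIdentityProofs using (module Decidable⇒UIP)
open import Data.Bool.Base using (Bool; true; false; T; not; _∧_; _∨_; _xor_; if_then_else_)
open import Data.Bool.ListAction using (all; any)
import Data.Bool.Properties as Bool
open import Data.Bool.Properties
  using (T?; T-irrelevant; xor-assoc; xor-comm; xor-identityˡ; xor-same; ∧-comm; ∧-zeroʳ; ∧-distribʳ-xor)
open import Data.Empty using (⊥; ⊥-elim)
open import Data.Fin.Base as Fin using (Fin)
import Data.Fin.Properties as Fin
open import Data.Fin.Properties using (pigeonhole; punchOut-injective)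
open import Data.Integer.Base as ℤ using (ℤ; +_)
import Data.Integer.Properties as ℤ
open import Data.List.Base as List using (List; []; _∷_; _++_; concatMap; length)
open import Data.List.Membership.Propositional using (_∈_; lose; find)
open import Data.List.Membership.Propositional.Properties
  using (∈-map⁺; ∈-concatMap⁺; ∈-++⁺ˡ; ∈-++⁺ʳ; ∈-filter⁺; ∈-filter⁻; ∈-lookup)
open import Data.List.Relation.Unary.All as All using (All)
open import Data.List.Relation.Unary.All.Properties using (all⁺; all⁻; ¬All⇒Any¬; all-filter)
open import Data.List.Relation.Unary.AllPairs as AllPairs using (AllPairs)
open import Data.List.Relation.Unary.Any as Any using (Any; here; there)
open import Data.List.Relation.Unary.Any.Properties using (any⁺; any⁻; mapMaybe⁺; lookup-index)
open import Data.List.Relation.Unary.Unique.Propositional using (Unique)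
import Data.List.Relation.Unary.Unique.Propositional.Properties as Unique
open import Data.Maybe.Base as Maybe using (Maybe; just)
import Data.Maybe.Relation.Unary.Any as MaybeAny
open import Data.Nat.Base as ℕ using (ℕ; zero; suc; _≤_; _<_; _^_; z≤n; s≤s)
open import Data.Nat.Logarithm using (⌊log₂_⌋; ⌊log₂[2^n]⌋≡n; ⌊log₂⌋-mono-≤)
import Data.Nat.Properties as ℕ
open import Data.Product.Base using (Σ; ∃; _×_; _,_; proj₁; proj₂)
open import Data.Sum.Base using (_⊎_; inj₁; inj₂)
open import Data.Unit.Base using (tt)
open import Data.Vec.Base as Vec using (Vec; []; _∷_; replicate; zipWith)
import Data.Vec.Properties as Vec
import Data.Vec.Relation.Unary.All as VecAll
import Data.Vec.Relation.Unary.All.Properties as VecAll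
open import Function.Base using (_∘_)
open import Function.Bundles using (_↔_; Inverse)
open import Relation.Binary.PropositionalEquality
open import Relation.Nullary using (¬_; Dec; yes; no)
open import Relation.Nullary.Decidable using (toWitness; toWitnessFalse; decidable-stable; dec⇒maybe; ¬?)

open import Data.List.Relation.Unary.Unique.DecPropositional (Vec.≡-dec {n = 4} Bool._≟_) using (unique?)
open import Defs

∧-intro : ∀ {a b} → T a → T b → T (a ∧ b)
∧-intro {true} _ q = q

∧-elimˡ : ∀ {a b} → T (a ∧ b) → T a
∧-elimˡ {true} _ = tt

∧-elimʳ : ∀ {a b} → T (a ∧ b) → T b
∧-elimʳ {true} q = q

∨-intro : ∀ {a b} → T a ⊎ T b → T (a ∨ b)
∨-intro {true}  _        = tt
∨-intro {false} (inj₂ p) = p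

∨-introˡ : ∀ {a b} → T a → T (a ∨ b)
∨-introˡ p = ∨-intro (inj₁ p)

∨-elim : ∀ {a b} → T (a ∨ b) → T a ⊎ T b
∨-elim {true}  p = inj₁ p
∨-elim {false} p = inj₂ p

⇒-intro : ∀ {a b} → (T a → T b) → T (not a ∨ b)
⇒-intro {false} f = tt
⇒-intro {true}  f = f tt

⇒-elim : ∀ {a b} → T (not a ∨ b) → T a → T b
⇒-elim {true} p _ = p

⇏-elim : ∀ {a b} → ¬ T (not a ∨ b) → T a × ¬ T b
⇏-elim {false} ¬a⇒b = ⊥-elim (¬a⇒b tt)
⇏-elim {true}  ¬a⇒b = tt , ¬a⇒b

T-not⇒≡false : ∀ {b} → T (not b) → b ≡ false
T-not⇒≡false {false} _ = refl

T-not⇒¬T : ∀ {b} → T (not b) → ¬ T b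
T-not⇒¬T {false} _  ()
T-not⇒¬T {true}  ()

T-⇔⇒≡ : ∀ {a b} → (T a → T b) → (T b → T a) → a ≡ b
T-⇔⇒≡ {false} {false} _ _ = refl
T-⇔⇒≡ {false} {true}  _ g = ⊥-elim (g tt)
T-⇔⇒≡ {true}  {false} f _ = ⊥-elim (f tt)
T-⇔⇒≡ {true}  {true}  _ _ = refl

Enumerates : {A : Set} → List A → Set
Enumerates xs = ∀ x → x ∈ xs

module _ {A : Set} {xs : List A} (enum : Enumerates xs) where

  all-elim : (p : A → Bool) → T (all p xs) → ∀ x → T (p x)
  all-elim p h x = All.lookup (all⁺ p xs h) (enum x)

  any-intro : (p : A → Bool) {x : A} → T (p x) → T (any p xs)
  any-intro p {x} px = any⁺ p (lose (enum x) px)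

  ⊆-or-counterexample : (P Q : A → Bool) →
    (∀ x → T (P x) → T (Q x)) ⊎ ∃ λ x → T (P x) × ¬ T (Q x)
  ⊆-or-counterexample P Q with All.all? (λ x → T? (not (P x) ∨ Q x)) xs
  ... | yes P⊆Q = inj₁ λ x → ⇒-elim (All.lookup P⊆Q (enum x))
  ... | no P⊈Q  with Any.satisfied (¬All⇒Any¬ (λ x → T? (not (P x) ∨ Q x)) xs P⊈Q)
  ...   | x , ¬P⇒Q = inj₂ (x , ⇏-elim ¬P⇒Q)

all-intro : {A : Set} (p : A → Bool) {xs : List A} → (∀ x → T (p x)) → T (all p xs)
all-intro p {xs} h = all⁻ p (All.universal {P = T ∘ p} h xs)

any-elim : {A : Set} (p : A → Bool) {xs : List A} → T (any p xs) → ∃ λ x → T (p x)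
any-elim p {xs} h = Any.satisfied (any⁻ p xs h)

enumerates-allVecsOf : {A : Set} {xs : List A} → Enumerates xs → ∀ n → Enumerates (allVecsOf xs n)
enumerates-allVecsOf enum zero    []      = here refl
enumerates-allVecsOf enum (suc n) (x ∷ v) = ∈-concatMap⁺ (λ y → List.map (y ∷_) (allVecsOf _ n))
  (lose (enum x) (∈-map⁺ (x ∷_) (enumerates-allVecsOf enum n v)))

∑ : {A : Set} → List A → (A → ℕ) → ℕ
∑ []       f = 0
∑ (x ∷ xs) f = f x ℕ.+ ∑ xs f

∑-++ : {A : Set} (xs ys : List A) (f : A → ℕ) → ∑ (xs ++ ys) f ≡ ∑ xs f ℕ.+ ∑ ys f
∑-++ []       ys f = refl
∑-++ (x ∷ xs) ys f = trans (cong (f x ℕ.+_) (∑-++ xs ys f)) (sym (ℕ.+-assoc (f x) _ _))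

module _ {A : Set} where

  ∑-cong : (xs : List A) {f g : A → ℕ} → (∀ x → f x ≡ g x) → ∑ xs f ≡ ∑ xs g
  ∑-cong []       f≡g = refl
  ∑-cong (x ∷ xs) f≡g = cong₂ ℕ._+_ (f≡g x) (∑-cong xs f≡g)

  ∑-map : {B : Set} (h : A → B) (xs : List A) (f : B → ℕ) → ∑ (List.map h xs) f ≡ ∑ xs (f ∘ h)
  ∑-map h []       f = refl
  ∑-map h (x ∷ xs) f = cong (f (h x) ℕ.+_) (∑-map h xs f)

  ∑-concatMap : {B : Set} (h : A → List B) (xs : List A) (f : B → ℕ) →
                ∑ (concatMap h xs) f ≡ ∑ xs (λ x → ∑ (h x) f)
  ∑-concatMap h []       f = refl
  ∑-concatMap h (x ∷ xs) f =
    trans (∑-++ (h x) (concatMap h xs) f) (cong (∑ (h x) f ℕ.+_) (∑-concatMap h xs f))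

  ∑-zero : (xs : List A) → ∑ xs (λ _ → 0) ≡ 0
  ∑-zero []       = refl
  ∑-zero (x ∷ xs) = ∑-zero xs

𝟙 : Bool → ℕ
𝟙 b = if b then 1 else 0

module _ {A : Set} where

  count≡∑ : (xs : List A) (P : A → Bool) → count xs P ≡ ∑ xs (𝟙 ∘ P)
  count≡∑ []       P = refl
  count≡∑ (x ∷ xs) P with P x
  ... | true  = cong suc (count≡∑ xs P)
  ... | false = count≡∑ xs P

  count-mono : (xs : List A) {P Q : A → Bool} → (∀ x → T (P x) → T (Q x)) →
               count xs P ≤ count xs Q
  count-mono []       P⊆Q = z≤n
  count-mono (x ∷ xs) {P} {Q} P⊆Q with P x in Px | Q x in Qx
  ... | false | false = count-mono xs P⊆Q
  ... | false | true  = ℕ.m≤n⇒m≤1+n (count-mono xs P⊆Q)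
  ... | true  | true  = s≤s (count-mono xs P⊆Q)
  ... | true  | false = ⊥-elim (subst T Qx (P⊆Q x (subst T (sym Px) tt)))

  count-cong : (xs : List A) {P Q : A → Bool} → (∀ x → P x ≡ Q x) → count xs P ≡ count xs Q
  count-cong xs P≡Q =
    ℕ.≤-antisym (count-mono xs (λ x → subst T (P≡Q x))) (count-mono xs (λ x → subst T (sym (P≡Q x))))

  count-≤⇒⊇ : (xs : List A) {P Q : A → Bool} → (∀ x → T (P x) → T (Q x)) →
              count xs Q ≤ count xs P → ∀ {x} → x ∈ xs → T (Q x) → T (P x)
  count-≤⇒⊇ (y ∷ xs) {P} {Q} P⊆Q Q≤P x∈ Qx with P y in Py | Q y in Qy | x∈
  ... | true  | true  | here refl  = subst T (sym Py) tt
  ... | true  | true  | there x∈xs = count-≤⇒⊇ xs P⊆Q (ℕ.s≤s⁻¹ Q≤P) x∈xs Qx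
  ... | false | false | here refl  = ⊥-elim (subst T Qy Qx)
  ... | false | false | there x∈xs = count-≤⇒⊇ xs P⊆Q Q≤P x∈xs Qx
  ... | false | true  | _ = ⊥-elim (ℕ.<-irrefl refl (ℕ.<-≤-trans Q≤P (count-mono xs P⊆Q)))
  ... | true  | false | _ = ⊥-elim (subst T Qy (P⊆Q y (subst T (sym Py) tt)))

  count-∨+count-∧ : (xs : List A) (P Q : A → Bool) →
    count xs (λ x → P x ∨ Q x) ℕ.+ count xs (λ x → P x ∧ Q x) ≡ count xs P ℕ.+ count xs Q
  count-∨+count-∧ []       P Q = refl
  count-∨+count-∧ (x ∷ xs) P Q with P x | Q x | count-∨+count-∧ xs P Q
  ... | true  | true  | ih = cong suc (trans (ℕ.+-suc _ _) (trans (cong suc ih) (sym (ℕ.+-suc _ _))))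
  ... | true  | false | ih = cong suc ih
  ... | false | true  | ih = trans (cong suc ih) (sym (ℕ.+-suc _ _))
  ... | false | false | ih = ih

  count-none : (xs : List A) (P : A → Bool) → (∀ x → ¬ T (P x)) → count xs P ≡ 0
  count-none []       P none = refl
  count-none (x ∷ xs) P none with P x in Px
  ... | true  = ⊥-elim (none x (subst T (sym Px) tt))
  ... | false = count-none xs P none

  count+count-not : (xs : List A) (P : A → Bool) → count xs P ℕ.+ count xs (not ∘ P) ≡ length xs
  count+count-not []       P = refl
  count+count-not (x ∷ xs) P with P x
  ... | true  = cong suc (count+count-not xs P)
  ... | false = trans (ℕ.+-suc _ _) (cong suc (count+count-not xs P))

allPairs-with : ∀ {A : Set} {P : A → Set} {R S : A → A → Set} {xs} → All P xs → AllPairs R xs →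
                (∀ {x y} → P x → P y → R x y → S x y) → AllPairs S xs
allPairs-with All.[]         AllPairs.[]         f = AllPairs.[]
allPairs-with (px All.∷ pxs) (rx AllPairs.∷ rxs) f =
  All.zipWith (λ (py , r) → f px py r) (pxs , rx) AllPairs.∷ allPairs-with pxs rxs f

module _ {A I : Set} (xs : List A) (Z : A → Bool) (K : I → A → Bool) where

  ⋃ : List I → A → Bool
  ⋃ []       = Z
  ⋃ (i ∷ is) x = K i x ∨ ⋃ is x

  ⋃-⊆ : ∀ {Q : A → Bool} → (∀ x → T (Z x) → T (Q x)) → (∀ i x → T (K i x) → T (Q x)) →
        ∀ is x → T (⋃ is x) → T (Q x)
  ⋃-⊆ Z⊆Q K⊆Q []       x x∈ = Z⊆Q x x∈
  ⋃-⊆ Z⊆Q K⊆Q (i ∷ is) x x∈ with ∨-elim {K i x} x∈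
  ... | inj₁ x∈Kᵢ = K⊆Q i x x∈Kᵢ
  ... | inj₂ x∈⋃ = ⋃-⊆ Z⊆Q K⊆Q is x x∈⋃

  MeetInZ : I → I → Set
  MeetInZ i j = ∀ x → T (K i x) → T (K j x) → T (Z x)

  count-⋃ : ∀ {a is} → All (λ i → a ≤ count xs (K i)) is → AllPairs MeetInZ is →
            count xs Z ℕ.+ length is ℕ.* a ≤ count xs (⋃ is) ℕ.+ length is ℕ.* count xs Z
  count-⋃ {is = []}     All.[]             AllPairs.[]                 = ℕ.≤-refl
  count-⋃ {a} {i ∷ is} (a≤Kᵢ All.∷ a≤K) (i∩is⊆Z AllPairs.∷ pairs) = begin
    cZ ℕ.+ (a ℕ.+ r ℕ.* a)          ≡⟨ ℕ.+-assoc cZ a _ ⟨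
    cZ ℕ.+ a ℕ.+ r ℕ.* a            ≡⟨ cong (ℕ._+ r ℕ.* a) (ℕ.+-comm cZ a) ⟩
    a ℕ.+ cZ ℕ.+ r ℕ.* a            ≡⟨ ℕ.+-assoc a cZ _ ⟩
    a ℕ.+ (cZ ℕ.+ r ℕ.* a)          ≤⟨ ℕ.+-mono-≤ a≤Kᵢ (count-⋃ a≤K pairs) ⟩
    cK ℕ.+ (c⋃ ℕ.+ r ℕ.* cZ)        ≡⟨ ℕ.+-assoc cK c⋃ _ ⟨
    cK ℕ.+ c⋃ ℕ.+ r ℕ.* cZ          ≡⟨ cong (ℕ._+ r ℕ.* cZ) (count-∨+count-∧ xs (K i) (⋃ is)) ⟨
    c∨ ℕ.+ c∧ ℕ.+ r ℕ.* cZ          ≤⟨ ℕ.+-monoˡ-≤ (r ℕ.* cZ) (ℕ.+-monoʳ-≤ c∨ c∧≤cZ) ⟩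
    c∨ ℕ.+ cZ ℕ.+ r ℕ.* cZ          ≡⟨ ℕ.+-assoc c∨ cZ _ ⟩
    c∨ ℕ.+ (cZ ℕ.+ r ℕ.* cZ)        ∎
    where
    open ℕ.≤-Reasoning
    r = length is
    cZ = count xs Z
    cK = count xs (K i)
    c⋃ = count xs (⋃ is)
    c∨ = count xs (λ x → K i x ∨ ⋃ is x)
    c∧ = count xs (λ x → K i x ∧ ⋃ is x)
    meetAll⊆Z : ∀ {js} → All (MeetInZ i) js → ∀ x → T (K i x) → T (⋃ js x) → T (Z x)
    meetAll⊆Z All.[]              x x∈Kᵢ x∈Z = x∈Z
    meetAll⊆Z {j ∷ js} (meetⱼ All.∷ meets) x x∈Kᵢ x∈⋃ with ∨-elim {K j x} x∈⋃
    ... | inj₁ x∈Kⱼ = meetⱼ x x∈Kᵢ x∈Kⱼ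
    ... | inj₂ x∈⋃′ = meetAll⊆Z meets x x∈Kᵢ x∈⋃′
    meet⊆Z : ∀ x → T (K i x ∧ ⋃ is x) → T (Z x)
    meet⊆Z x x∈ = meetAll⊆Z i∩is⊆Z x (∧-elimˡ {K i x} x∈) (∧-elimʳ {K i x} x∈)
    c∧≤cZ : c∧ ≤ cZ
    c∧≤cZ = count-mono xs meet⊆Z

-- Finite F₂-vector spaces

-- Of `elements` listing every vector exactly once, only the two consequences used
-- by the counting arguments are recorded: sums over it are translation invariant,
-- and 0 is listed once.
record F₂Space : Set₁ where
  infixl 6 _+_
  field
    Vector       : Set
    0#           : Vector
    _+_          : Vector → Vector → Vector
    +-assoc      : ∀ x y z → (x + y) + z ≡ x + (y + z)
    +-comm       : ∀ x y → x + y ≡ y + x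
    +-identityˡ  : ∀ x → 0# + x ≡ x
    +-self       : ∀ x → x + x ≡ 0#
    isZero       : Vector → Bool
    isZero-sound : ∀ x → T (isZero x) → x ≡ 0#
    isZero-0#    : T (isZero 0#)
    elements     : List Vector
    enumerates   : Enumerates elements
    ∑-translate  : ∀ (f : Vector → ℕ) c → ∑ elements (λ x → f (x + c)) ≡ ∑ elements f
    count-isZero : count elements isZero ≡ 1

module F₂SpaceProperties (V : F₂Space) where
  open F₂Space V public

  +-identityʳ : ∀ x → x + 0# ≡ x
  +-identityʳ x = trans (+-comm x 0#) (+-identityˡ x)

  +-cancelʳ : ∀ x c → (x + c) + c ≡ x
  +-cancelʳ x c = trans (+-assoc x c c) (trans (cong (λ y → x + y) (+-self c)) (+-identityʳ x))

  +-cancelˡ : ∀ x c → x + (x + c) ≡ c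
  +-cancelˡ x c = trans (sym (+-assoc x x c)) (trans (cong (λ y → y + c) (+-self x)) (+-identityˡ c))

  +-swapʳ : ∀ x y c → (x + c) + y ≡ (x + y) + c
  +-swapʳ x y c = trans (+-assoc x c y) (trans (cong (λ z → x + z) (+-comm c y)) (sym (+-assoc x y c)))

  +-interchange : ∀ a b c d → (a + b) + (c + d) ≡ (a + c) + (b + d)
  +-interchange a b c d = begin
    (a + b) + (c + d) ≡⟨ +-assoc a b (c + d) ⟩
    a + (b + (c + d)) ≡⟨ cong (λ x → a + x) (+-assoc b c d) ⟨
    a + ((b + c) + d) ≡⟨ cong (λ x → a + (x + d)) (+-comm b c) ⟩
    a + ((c + b) + d) ≡⟨ cong (λ x → a + x) (+-assoc c b d) ⟩
    a + (c + (b + d)) ≡⟨ +-assoc a c (b + d) ⟨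
    (a + c) + (b + d) ∎
    where open ≡-Reasoning

  +-cancel-both : ∀ x y c → (x + c) + (y + c) ≡ x + y
  +-cancel-both x y c =
    trans (+-interchange x c y c) (trans (cong (λ z → (x + y) + z) (+-self c)) (+-identityʳ (x + y)))

  record Linear (S : Vector → Bool) : Set where
    field
      0∈       : T (S 0#)
      +-closed : ∀ {x y} → T (S x) → T (S y) → T (S (x + y))
  open Linear

  isLinear⇒Linear : ∀ {S} → T (isLinear elements 0# _+_ S) → Linear S
  isLinear⇒Linear {S} lin = record
    { 0∈       = ∧-elimˡ lin
    ; +-closed = λ {x} {y} Sx Sy →
        ⇒-elim (all-elim enumerates _ (all-elim enumerates _ (∧-elimʳ {S 0#} lin) x) y) (∧-intro Sx Sy)
    }

  Linear⇒isLinear : ∀ {S} → Linear S → T (isLinear elements 0# _+_ S)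
  Linear⇒isLinear {S} L =
    ∧-intro {S 0#} (0∈ L) (all-intro (λ x → all (closedAt x) elements) {elements} λ x →
      all-intro (closedAt x) {elements} λ y →
        ⇒-intro {S x ∧ S y} λ Sx∧Sy → +-closed L (∧-elimˡ {S x} Sx∧Sy) (∧-elimʳ {S x} Sx∧Sy))
    where
    closedAt : Vector → Vector → Bool
    closedAt x y = not (S x ∧ S y) ∨ S (x + y)

  Linear-resp : ∀ {P Q} → (∀ x → P x ≡ Q x) → Linear P → Linear Q
  Linear-resp P≡Q linP = record
    { 0∈       = subst T (P≡Q 0#) (0∈ linP)
    ; +-closed = λ Qx Qy →
        subst T (P≡Q _) (+-closed linP (subst T (sym (P≡Q _)) Qx) (subst T (sym (P≡Q _)) Qy))
    }

  count-translate : (P : Vector → Bool) (c : Vector) →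
                    count elements (λ x → P (x + c)) ≡ count elements P
  count-translate P c = begin
    count elements (λ x → P (x + c)) ≡⟨ count≡∑ elements _ ⟩
    ∑ elements (λ x → 𝟙 (P (x + c))) ≡⟨ ∑-translate (𝟙 ∘ P) c ⟩
    ∑ elements (𝟙 ∘ P)               ≡⟨ count≡∑ elements P ⟨
    count elements P                 ∎
    where open ≡-Reasoning

  _+⟨_⟩ : (Vector → Bool) → Vector → Vector → Bool
  (R +⟨ c ⟩) x = R x ∨ R (x + c)

  module _ {R : Vector → Bool} (linR : Linear R) (c : Vector) where

    private
      R∋ : ∀ {x y} → x ≡ y → T (R x) → T (R y)
      R∋ x≡y = subst (T ∘ R) x≡y

      closed : ∀ {x y} → T (R x) ⊎ T (R (x + c)) → T (R y) ⊎ T (R (y + c)) →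
               T (R (x + y)) ⊎ T (R ((x + y) + c))
      closed         (inj₁ Rx)  (inj₁ Ry)  = inj₁ (+-closed linR Rx Ry)
      closed {x} {y} (inj₁ Rx)  (inj₂ Ryc) = inj₂ (R∋ (sym (+-assoc x y c)) (+-closed linR Rx Ryc))
      closed {x} {y} (inj₂ Rxc) (inj₁ Ry)  = inj₂ (R∋ (+-swapʳ x y c) (+-closed linR Rxc Ry))
      closed {x} {y} (inj₂ Rxc) (inj₂ Ryc) = inj₁ (R∋ (+-cancel-both x y c) (+-closed linR Rxc Ryc))

    +⟨⟩-linear : Linear (R +⟨ c ⟩)
    +⟨⟩-linear = record
      { 0∈       = ∨-introˡ (0∈ linR)
      ; +-closed = λ p q → ∨-intro (closed (∨-elim p) (∨-elim q))
      }

    +⟨⟩-⊆ : ∀ {S} → Linear S → (∀ x → T (R x) → T (S x)) → T (S c) →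
            ∀ x → T ((R +⟨ c ⟩) x) → T (S x)
    +⟨⟩-⊆ {S} linS R⊆S Sc x p with ∨-elim p
    ... | inj₁ Rx  = R⊆S x Rx
    ... | inj₂ Rxc = subst (T ∘ S) (+-cancelʳ x c) (+-closed linS (R⊆S _ Rxc) Sc)

    count-+⟨⟩ : ¬ T (R c) → count elements (R +⟨ c ⟩) ≡ count elements R ℕ.+ count elements R
    count-+⟨⟩ ¬Rc = begin
      count elements (R +⟨ c ⟩)                 ≡⟨ ℕ.+-identityʳ _ ⟨
      count elements (R +⟨ c ⟩) ℕ.+ 0           ≡⟨ cong (count elements (R +⟨ c ⟩) ℕ.+_) disjoint ⟨
      count elements (R +⟨ c ⟩) ℕ.+ count elements (λ x → R x ∧ R (x + c))
        ≡⟨ count-∨+count-∧ elements R (λ x → R (x + c)) ⟩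
      count elements R ℕ.+ count elements (λ x → R (x + c))
        ≡⟨ cong (count elements R ℕ.+_) (count-translate R c) ⟩
      count elements R ℕ.+ count elements R    ∎
      where
      open ≡-Reasoning
      disjoint : count elements (λ x → R x ∧ R (x + c)) ≡ 0
      disjoint = count-none elements _ λ x Rx∧Rxc →
        ¬Rc (R∋ (+-cancelˡ x c) (+-closed linR (∧-elimˡ Rx∧Rxc) (∧-elimʳ Rx∧Rxc)))

  isZero-linear : Linear isZero
  isZero-linear = record
    { 0∈       = isZero-0#
    ; +-closed = λ {x} {y} x≡0 y≡0 → subst (T ∘ isZero)
        (sym (trans (cong₂ _+_ (isZero-sound x x≡0) (isZero-sound y y≡0)) (+-self 0#))) isZero-0#
    }

  isZero⊆ : ∀ {S} → Linear S → ∀ x → T (isZero x) → T (S x)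
  isZero⊆ {S} linS x x≡0 = subst (T ∘ S) (sym (isZero-sound x x≡0)) (0∈ linS)

  -- Starting from R = {0}, replace R by R +⟨ c ⟩ for some c ∈ S ∖ R, doubling |R|,
  -- until S ⊆ R; the fuel |S| bounds the number of steps.
  linear⇒count≡2^ : ∀ {S} → Linear S → ∃ λ k → count elements S ≡ 2 ^ k
  linear⇒count≡2^ {S} linS =
    grow (count elements S) 0 isZero-linear (isZero⊆ linS) count-isZero (ℕ.m≤m+n _ _)
    where
    grow : ∀ fuel {R} j → Linear R → (∀ x → T (R x) → T (S x)) → count elements R ≡ 2 ^ j →
           count elements S ≤ fuel ℕ.+ count elements R → ∃ λ k → count elements S ≡ 2 ^ k
    grow fuel {R} j linR R⊆S |R|≡2^j |S|≤ with ⊆-or-counterexample enumerates S R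
    ... | inj₁ S⊆R = j , trans (ℕ.≤-antisym (count-mono elements S⊆R) (count-mono elements R⊆S)) |R|≡2^j
    ... | inj₂ (c , Sc , ¬Rc) = extend fuel |S|≤
      where
      |R+⟨c⟩|≡2^1+j : count elements (R +⟨ c ⟩) ≡ 2 ^ suc j
      |R+⟨c⟩|≡2^1+j =
        trans (count-+⟨⟩ linR c ¬Rc) (cong₂ ℕ._+_ |R|≡2^j (trans |R|≡2^j (sym (ℕ.+-identityʳ _))))

      |R|<|R+⟨c⟩| : count elements R < count elements (R +⟨ c ⟩)
      |R|<|R+⟨c⟩| = subst₂ _<_ (sym |R|≡2^j) (sym |R+⟨c⟩|≡2^1+j)
        (ℕ.m<m+n (2 ^ j) (ℕ.<-≤-trans (ℕ.m^n>0 2 j) (ℕ.m≤m+n _ _)))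

      R+⟨c⟩⊆S : ∀ x → T ((R +⟨ c ⟩) x) → T (S x)
      R+⟨c⟩⊆S = +⟨⟩-⊆ linR c linS R⊆S Sc

      extend : ∀ fuel → count elements S ≤ fuel ℕ.+ count elements R → ∃ λ k → count elements S ≡ 2 ^ k
      extend zero       |S|≤ =
        ⊥-elim (ℕ.<-irrefl refl (ℕ.≤-<-trans |S|≤ (ℕ.<-≤-trans |R|<|R+⟨c⟩| (count-mono elements R+⟨c⟩⊆S))))
      extend (suc fuel) |S|≤ = grow fuel (suc j) (+⟨⟩-linear linR c) R+⟨c⟩⊆S |R+⟨c⟩|≡2^1+j
        (ℕ.≤-trans |S|≤ (subst (_≤ fuel ℕ.+ count elements (R +⟨ c ⟩)) (ℕ.+-suc fuel _)
                                (ℕ.+-monoʳ-≤ fuel |R|<|R+⟨c⟩|)))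

  linear⇒count≡2^dim : ∀ {S} → Linear S → count elements S ≡ 2 ^ dim₂ elements S
  linear⇒count≡2^dim {S} linS with linear⇒count≡2^ linS
  ... | k , |S|≡2^k =
    trans |S|≡2^k (cong (2 ^_) (sym (trans (cong ⌊log₂_⌋ |S|≡2^k) (⌊log₂[2^n]⌋≡n k))))

𝔽₂ : F₂Space
𝔽₂ = record
  { Vector       = Bool
  ; 0#           = false
  ; _+_          = _xor_
  ; +-assoc      = xor-assoc
  ; +-comm       = xor-comm
  ; +-identityˡ  = xor-identityˡ
  ; +-self       = xor-same
  ; isZero       = not
  ; isZero-sound = isZero-sound
  ; isZero-0#    = tt
  ; elements     = false ∷ true ∷ []
  ; enumerates   = enumerates
  ; ∑-translate  = ∑-translate
  ; count-isZero = refl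
  }
  where
  isZero-sound : ∀ x → T (not x) → x ≡ false
  isZero-sound false _ = refl

  enumerates : Enumerates (false ∷ true ∷ [])
  enumerates false = here refl
  enumerates true  = there (here refl)

  ∑-translate : ∀ (f : Bool → ℕ) c →
                ∑ (false ∷ true ∷ []) (λ x → f (x xor c)) ≡ ∑ (false ∷ true ∷ []) f
  ∑-translate f false = refl
  ∑-translate f true = begin
    f true ℕ.+ (f false ℕ.+ 0) ≡⟨ cong (f true ℕ.+_) (ℕ.+-identityʳ (f false)) ⟩
    f true ℕ.+ f false         ≡⟨ ℕ.+-comm (f true) (f false) ⟩
    f false ℕ.+ f true         ≡⟨ cong (f false ℕ.+_) (ℕ.+-identityʳ (f true)) ⟨
    f false ℕ.+ (f true ℕ.+ 0) ∎
    where open ≡-Reasoning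

vectors : F₂Space → ℕ → F₂Space
vectors V n = record
  { Vector       = Vec Vector n
  ; 0#           = replicate n 0#
  ; _+_          = zipWith _+_
  ; +-assoc      = Vec.zipWith-assoc +-assoc
  ; +-comm       = Vec.zipWith-comm +-comm
  ; +-identityˡ  = Vec.zipWith-identityˡ +-identityˡ
  ; +-self       = zipWith-self
  ; isZero       = isZeroᵛ
  ; isZero-sound = isZeroᵛ-sound
  ; isZero-0#    = isZeroᵛ-0# {n}
  ; elements     = allVecsOf elements n
  ; enumerates   = enumerates-allVecsOf enumerates n
  ; ∑-translate  = ∑-translateᵛ n
  ; count-isZero = count-isZeroᵛ n
  }
  where
  open F₂Space V

  zipWith-self : ∀ {n} (v : Vec Vector n) → zipWith _+_ v v ≡ replicate n 0#
  zipWith-self []      = refl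
  zipWith-self (x ∷ v) = cong₂ _∷_ (+-self x) (zipWith-self v)

  isZeroᵛ : ∀ {n} → Vec Vector n → Bool
  isZeroᵛ []      = true
  isZeroᵛ (x ∷ v) = isZero x ∧ isZeroᵛ v

  isZeroᵛ-sound : ∀ {n} (v : Vec Vector n) → T (isZeroᵛ v) → v ≡ replicate n 0#
  isZeroᵛ-sound []      _ = refl
  isZeroᵛ-sound (x ∷ v) p =
    cong₂ _∷_ (isZero-sound x (∧-elimˡ p)) (isZeroᵛ-sound v (∧-elimʳ {isZero x} p))

  isZeroᵛ-0# : ∀ {n} → T (isZeroᵛ (replicate n 0#))
  isZeroᵛ-0# {zero}  = tt
  isZeroᵛ-0# {suc n} = ∧-intro isZero-0# (isZeroᵛ-0# {n})

  slice : ∀ {n} → Vector → List (Vec Vector (suc n))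
  slice {n} x = List.map (x ∷_) (allVecsOf elements n)

  ∑-translateᵛ : ∀ n (f : Vec Vector n → ℕ) c →
    ∑ (allVecsOf elements n) (λ v → f (zipWith _+_ v c)) ≡ ∑ (allVecsOf elements n) f
  ∑-translateᵛ zero    f [] = refl
  ∑-translateᵛ (suc n) f (c ∷ cs) = begin
    ∑ (concatMap (slice {n}) elements) (λ v → f (zipWith _+_ v (c ∷ cs)))
      ≡⟨ ∑-concatMap (slice {n}) elements _ ⟩
    ∑ elements (λ x → ∑ (slice {n} x) (λ v → f (zipWith _+_ v (c ∷ cs))))
      ≡⟨ ∑-cong elements (λ x → ∑-map (x ∷_) vs _) ⟩
    ∑ elements (λ x → ∑ vs (λ v → f ((x + c) ∷ zipWith _+_ v cs)))
      ≡⟨ ∑-cong elements (λ x → ∑-translateᵛ n (λ v → f ((x + c) ∷ v)) cs) ⟩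
    ∑ elements (λ x → fibre (x + c))
      ≡⟨ ∑-translate fibre c ⟩
    ∑ elements fibre
      ≡⟨ ∑-cong elements (λ x → ∑-map (x ∷_) vs f) ⟨
    ∑ elements (λ x → ∑ (slice {n} x) f)
      ≡⟨ ∑-concatMap (slice {n}) elements f ⟨
    ∑ (concatMap (slice {n}) elements) f ∎
    where
    open ≡-Reasoning
    vs = allVecsOf elements n
    fibre : Vector → ℕ
    fibre y = ∑ vs (λ v → f (y ∷ v))

  count-isZeroᵛ : ∀ n → count (allVecsOf elements n) isZeroᵛ ≡ 1
  count-isZeroᵛ zero    = refl
  count-isZeroᵛ (suc n) = begin
    count (concatMap (slice {n}) elements) isZeroᵛ    ≡⟨ count≡∑ (concatMap (slice {n}) elements) isZeroᵛ ⟩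
    ∑ (concatMap (slice {n}) elements) (𝟙 ∘ isZeroᵛ)  ≡⟨ ∑-concatMap (slice {n}) elements _ ⟩
    ∑ elements (λ x → ∑ (slice {n} x) (𝟙 ∘ isZeroᵛ))  ≡⟨ ∑-cong elements zeroesInSlice ⟩
    ∑ elements (𝟙 ∘ isZero)                           ≡⟨ count≡∑ elements isZero ⟨
    count elements isZero                             ≡⟨ count-isZero ⟩
    1                                                 ∎
    where
    open ≡-Reasoning
    vs = allVecsOf elements n
    zeroesInSlice : ∀ x → ∑ (slice {n} x) (𝟙 ∘ isZeroᵛ) ≡ 𝟙 (isZero x)
    zeroesInSlice x = trans (∑-map (x ∷_) vs _) (zeroesAfter (isZero x))
      where
      zeroesAfter : ∀ b → ∑ vs (λ v → 𝟙 (b ∧ isZeroᵛ v)) ≡ 𝟙 b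
      zeroesAfter true  = trans (sym (count≡∑ vs isZeroᵛ)) (count-isZeroᵛ n)
      zeroesAfter false = ∑-zero vs

-- F₂⁴ and matrices m unfold to the E₄, 0v, _⊕_ and allMats m, replicate m 0v,
-- zipWith _⊕_ of Defs, so the isLinear conditions there are linearity in these spaces.
F₂⁴ : F₂Space
F₂⁴ = vectors 𝔽₂ 4

matrices : ℕ → F₂Space
matrices m = vectors F₂⁴ m

module F₂⁴ = F₂SpaceProperties F₂⁴
module Matrices (m : ℕ) = F₂SpaceProperties (matrices m)
module 𝔽₂ = F₂SpaceProperties 𝔽₂

eqV-sound : ∀ {n} (u v : V₂ n) → T (eqV u v) → u ≡ v
eqV-sound []          []          _ = refl
eqV-sound (true ∷ u)  (true ∷ v)  p = cong (true ∷_) (eqV-sound u v p)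
eqV-sound (false ∷ u) (false ∷ v) p = cong (false ∷_) (eqV-sound u v p)

eqV-refl : ∀ {n} (v : V₂ n) → T (eqV v v)
eqV-refl []          = tt
eqV-refl (true ∷ v)  = eqV-refl v
eqV-refl (false ∷ v) = eqV-refl v

E₄-unique : Unique E₄
E₄-unique = toWitness {a? = unique? E₄} tt

mem-toTree : ∀ {n} (P : V₂ n → Bool) v → mem (toTree P) v ≡ P v
mem-toTree {zero}  P []          = refl
mem-toTree {suc n} P (false ∷ v) = mem-toTree (λ w → P (false ∷ w)) v
mem-toTree {suc n} P (true ∷ v)  = mem-toTree (λ w → P (true ∷ w)) v

toTree-mem : ∀ {n} (t : Tree n) → toTree (mem t) ≡ t
toTree-mem {zero}  b         = refl
toTree-mem {suc n} (t₀ , t₁) = cong₂ _,_ (toTree-mem t₀) (toTree-mem t₁)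

toTree-cong : ∀ {n} {P Q : V₂ n → Bool} → (∀ v → P v ≡ Q v) → toTree P ≡ toTree Q
toTree-cong {zero}  P≡Q = P≡Q []
toTree-cong {suc n} P≡Q = cong₂ _,_ (toTree-cong (P≡Q ∘ (false ∷_))) (toTree-cong (P≡Q ∘ (true ∷_)))

∈ˢ-linear : (U : Subspace) → F₂⁴.Linear (_∈ˢ U)
∈ˢ-linear U = F₂⁴.isLinear⇒Linear (linear U)

subspace : (P : V₂ 4 → Bool) → F₂⁴.Linear P → Subspace
subspace P linP = sub (toTree P) (F₂⁴.Linear⇒isLinear (F₂⁴.Linear-resp (sym ∘ mem-toTree P) linP))

line-linear : ∀ v → F₂⁴.Linear (F₂⁴.isZero F₂⁴.+⟨ v ⟩)
line-linear = F₂⁴.+⟨⟩-linear F₂⁴.isZero-linear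

line : V₂ 4 → Subspace
line v = subspace (F₂⁴.isZero F₂⁴.+⟨ v ⟩) (line-linear v)

module _ (A B : Subspace) where

  sumP-intro : ∀ {a v} → T (a ∈ˢ A) → T ((a ⊕ v) ∈ˢ B) → T (sumP A B v)
  sumP-intro {a} {v} a∈A a+v∈B =
    any-intro F₂⁴.enumerates (λ u → (u ∈ˢ A) ∧ ((u ⊕ v) ∈ˢ B)) {a} (∧-intro {a ∈ˢ A} a∈A a+v∈B)

  sumP-elim : ∀ {v} → T (sumP A B v) → ∃ λ a → T (a ∈ˢ A) × T ((a ⊕ v) ∈ˢ B)
  sumP-elim {v} p with any-elim (λ u → (u ∈ˢ A) ∧ ((u ⊕ v) ∈ˢ B)) {E₄} p
  ... | a , q = a , ∧-elimˡ {a ∈ˢ A} q , ∧-elimʳ {a ∈ˢ A} q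

  sumP-linear : F₂⁴.Linear (sumP A B)
  sumP-linear = record
    { 0∈       = sumP-intro {0v} {0v} (0∈ linA)
                   (subst (T ∘ (_∈ˢ B)) (sym (F₂⁴.+-identityˡ 0v)) (0∈ linB))
    ; +-closed = λ {x} {y} → closed {x} {y}
    }
    where
    open F₂⁴.Linear
    linA = ∈ˢ-linear A
    linB = ∈ˢ-linear B
    closed : ∀ {x y} → T (sumP A B x) → T (sumP A B y) → T (sumP A B (x ⊕ y))
    closed {x} {y} p q with sumP-elim p | sumP-elim q
    ... | a , a∈A , a+x∈B | b , b∈A , b+y∈B = sumP-intro {a ⊕ b} {x ⊕ y} (+-closed linA {a} {b} a∈A b∈A)
      (subst (T ∘ (_∈ˢ B)) (F₂⁴.+-interchange a x b y) (+-closed linB {a ⊕ x} {b ⊕ y} a+x∈B b+y∈B))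

_+ˢ_ : Subspace → Subspace → Subspace
A +ˢ B = subspace (sumP A B) (sumP-linear A B)

_∩ˢ_ : Subspace → Subspace → Subspace
A ∩ˢ B = subspace (interP A B)
  record { 0∈ = ∧-intro {0v ∈ˢ A} (0∈ linA) (0∈ linB) ; +-closed = λ {x} {y} → closed {x} {y} }
  where
  open F₂⁴.Linear
  linA = ∈ˢ-linear A
  linB = ∈ˢ-linear B
  closed : ∀ {x y} → T (interP A B x) → T (interP A B y) → T (interP A B (x ⊕ y))
  closed {x} {y} p q = ∧-intro {(x ⊕ y) ∈ˢ A}
    (+-closed linA {x} {y} (∧-elimˡ {x ∈ˢ A} p) (∧-elimˡ {y ∈ˢ A} q))
    (+-closed linB {x} {y} (∧-elimʳ {x ∈ˢ A} p) (∧-elimʳ {y ∈ˢ A} q))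

∈-subspace⁺ : ∀ {P} (linP : F₂⁴.Linear P) {v} → T (P v) → T (v ∈ˢ subspace P linP)
∈-subspace⁺ {P} _ {v} = subst T (sym (mem-toTree P v))

∈-subspace⁻ : ∀ {P} (linP : F₂⁴.Linear P) {v} → T (v ∈ˢ subspace P linP) → T (P v)
∈-subspace⁻ {P} _ {v} = subst T (mem-toTree P v)

dim-subspace : ∀ {P} (linP : F₂⁴.Linear P) → dim (subspace P linP) ≡ dim₂ E₄ P
dim-subspace {P} _ = cong ⌊log₂_⌋ (count-cong E₄ (mem-toTree P))

0∈line : ∀ v → T (0v ∈ˢ line v)
0∈line v = F₂⁴.Linear.0∈ (∈ˢ-linear (line v))

v∈line : ∀ v → T (v ∈ˢ line v)
v∈line v = ∈-subspace⁺ (line-linear v) {v}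
  (∨-intro {F₂⁴.isZero v} (inj₂ (subst (T ∘ F₂⁴.isZero) (sym (F₂⁴.+-self v)) F₂⁴.isZero-0#)))

∈line⁻ : ∀ {v w} → T (w ∈ˢ line v) → w ≡ 0v ⊎ w ≡ v
∈line⁻ {v} {w} p with ∨-elim {F₂⁴.isZero w} (∈-subspace⁻ (line-linear v) {w} p)
... | inj₁ w≡0   = inj₁ (F₂⁴.isZero-sound w w≡0)
... | inj₂ w+v≡0 = inj₂ (begin
  w            ≡⟨ F₂⁴.+-cancelʳ w v ⟨
  (w ⊕ v) ⊕ v  ≡⟨ cong (_⊕ v) (F₂⁴.isZero-sound (w ⊕ v) w+v≡0) ⟩
  0v ⊕ v       ≡⟨ F₂⁴.+-identityˡ v ⟩
  v            ∎)
  where open ≡-Reasoning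

dim-line : ∀ v → v ≢ 0v → dim (line v) ≡ 1
dim-line v v≢0 = begin
  dim (line v)                                         ≡⟨ dim-subspace (line-linear v) ⟩
  ⌊log₂ count E₄ (F₂⁴.isZero F₂⁴.+⟨ v ⟩) ⌋             ≡⟨ cong ⌊log₂_⌋ (F₂⁴.count-+⟨⟩ F₂⁴.isZero-linear v v≠0) ⟩
  ⌊log₂ count E₄ F₂⁴.isZero ℕ.+ count E₄ F₂⁴.isZero ⌋  ≡⟨ cong ⌊log₂_⌋ (cong₂ ℕ._+_ F₂⁴.count-isZero F₂⁴.count-isZero) ⟩
  1                                                    ∎
  where
  open ≡-Reasoning
  v≠0 : ¬ T (F₂⁴.isZero v)
  v≠0 = v≢0 ∘ F₂⁴.isZero-sound v

sumP-line : ∀ A v x → sumP A (line v) x ≡ ((_∈ˢ A) F₂⁴.+⟨ v ⟩) x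
sumP-line A v x = T-⇔⇒≡ to from
  where
  to : T (sumP A (line v) x) → T (((_∈ˢ A) F₂⁴.+⟨ v ⟩) x)
  to p with sumP-elim A (line v) {x} p
  ... | a , a∈A , a+x∈line with ∈line⁻ {v} {a ⊕ x} a+x∈line
  ...   | inj₁ a+x≡0 = ∨-intro {x ∈ˢ A} (inj₁ (subst (T ∘ (_∈ˢ A)) a≡x a∈A))
    where
    a≡x : a ≡ x
    a≡x = trans (sym (F₂⁴.+-identityʳ a)) (trans (cong (a ⊕_) (sym a+x≡0)) (F₂⁴.+-cancelˡ a x))
  ...   | inj₂ a+x≡v = ∨-intro {x ∈ˢ A} (inj₂ (subst (T ∘ (_∈ˢ A)) a≡x+v a∈A))
    where
    a≡x+v : a ≡ x ⊕ v
    a≡x+v = sym (trans (cong (x ⊕_) (sym a+x≡v)) (trans (F₂⁴.+-comm x (a ⊕ x)) (F₂⁴.+-cancelʳ a x)))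
  from : T (((_∈ˢ A) F₂⁴.+⟨ v ⟩) x) → T (sumP A (line v) x)
  from p with ∨-elim {x ∈ˢ A} p
  ... | inj₁ x∈A   = sumP-intro A (line v) {x} {x} x∈A (subst (T ∘ (_∈ˢ line v)) (sym (F₂⁴.+-self x)) (0∈line v))
  ... | inj₂ x+v∈A = sumP-intro A (line v) {x ⊕ v} {x} x+v∈A (subst (T ∘ (_∈ˢ line v)) x+v+x≡v (v∈line v))
    where
    x+v+x≡v : v ≡ (x ⊕ v) ⊕ x
    x+v+x≡v = sym (trans (F₂⁴.+-swapʳ x x v) (trans (cong (_⊕ v) (F₂⁴.+-self x)) (F₂⁴.+-identityˡ v)))

count-∈ˢ : ∀ A → count E₄ (_∈ˢ A) ≡ 2 ^ dim A
count-∈ˢ A = F₂⁴.linear⇒count≡2^dim (∈ˢ-linear A)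

dim-+ˢline : ∀ A v → ¬ T (v ∈ˢ A) → dim (A +ˢ line v) ≡ suc (dim A)
dim-+ˢline A v v∉A = begin
  dim (A +ˢ line v)                              ≡⟨ dim-subspace (sumP-linear A (line v)) ⟩
  ⌊log₂ count E₄ (sumP A (line v)) ⌋               ≡⟨ cong ⌊log₂_⌋ (count-cong E₄ (sumP-line A v)) ⟩
  ⌊log₂ count E₄ ((_∈ˢ A) F₂⁴.+⟨ v ⟩) ⌋          ≡⟨ cong ⌊log₂_⌋ (F₂⁴.count-+⟨⟩ (∈ˢ-linear A) v v∉A) ⟩
  ⌊log₂ count E₄ (_∈ˢ A) ℕ.+ count E₄ (_∈ˢ A) ⌋  ≡⟨ cong ⌊log₂_⌋ (cong₂ ℕ._+_ (count-∈ˢ A) (count-∈ˢ A)) ⟩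
  ⌊log₂ 2 ^ dim A ℕ.+ 2 ^ dim A ⌋               ≡⟨ cong (λ n → ⌊log₂ 2 ^ dim A ℕ.+ n ⌋) (ℕ.+-identityʳ _) ⟨
  ⌊log₂ 2 ^ suc (dim A) ⌋                       ≡⟨ ⌊log₂[2^n]⌋≡n (suc (dim A)) ⟩
  suc (dim A)                                   ∎
  where open ≡-Reasoning

dim-line+ˢline : ∀ {u v} → u ≢ 0v → v ≢ 0v → u ≢ v → dim (line u +ˢ line v) ≡ 2
dim-line+ˢline {u} {v} u≢0 v≢0 u≢v = trans (dim-+ˢline (line u) v v∉line) (cong suc (dim-line u u≢0))
  where
  v∉line : ¬ T (v ∈ˢ line u)
  v∉line v∈⟨u⟩ with ∈line⁻ {u} {v} v∈⟨u⟩
  ... | inj₁ v≡0 = v≢0 v≡0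
  ... | inj₂ v≡u = u≢v (sym v≡u)

∈-+ˢˡ : ∀ A B {a} → T (a ∈ˢ A) → T (a ∈ˢ (A +ˢ B))
∈-+ˢˡ A B {a} a∈A = ∈-subspace⁺ (sumP-linear A B) {a}
  (sumP-intro A B {a} {a} a∈A (subst (T ∘ (_∈ˢ B)) (sym (F₂⁴.+-self a)) (F₂⁴.Linear.0∈ (∈ˢ-linear B))))

dot-comm : ∀ {n} (u v : V₂ n) → dot u v ≡ dot v u
dot-comm []      []      = refl
dot-comm (a ∷ u) (b ∷ v) = cong₂ _xor_ (∧-comm a b) (dot-comm u v)

dot-0ʳ : ∀ {n} (u : V₂ n) → dot u 0v ≡ false
dot-0ʳ []      = refl
dot-0ʳ (a ∷ u) = cong₂ _xor_ (∧-zeroʳ a) (dot-0ʳ u)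

dot-⊕ˡ : ∀ {n} (u v w : V₂ n) → dot (u ⊕ v) w ≡ dot u w xor dot v w
dot-⊕ˡ []      []      []      = refl
dot-⊕ˡ (a ∷ u) (b ∷ v) (c ∷ w) =
  trans (cong₂ _xor_ (∧-distribʳ-xor c a b) (dot-⊕ˡ u v w))
        (𝔽₂.+-interchange (a ∧ c) (b ∧ c) (dot u w) (dot v w))

dot-⊕ʳ : ∀ {n} (u v w : V₂ n) → dot u (v ⊕ w) ≡ dot u v xor dot u w
dot-⊕ʳ u v w = trans (dot-comm u (v ⊕ w)) (trans (dot-⊕ˡ v w u) (cong₂ _xor_ (dot-comm v u) (dot-comm w u)))

∈-perpP⁺ : ∀ {P : V₂ 4 → Bool} {w} → (∀ u → T (P u) → dot u w ≡ false) → T (perpP P w)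
∈-perpP⁺ {P} {w} u⊥w = all-intro (λ u → not (P u) ∨ not (dot u w)) {E₄} λ u →
  ⇒-intro {P u} λ Pu → subst (T ∘ not) (sym (u⊥w u Pu)) tt

∈-perpP⁻ : ∀ {P : V₂ 4 → Bool} {w} → T (perpP P w) → ∀ {u} → T (P u) → dot u w ≡ false
∈-perpP⁻ {P} {w} p {u} Pu =
  T-not⇒≡false (⇒-elim {P u} (all-elim F₂⁴.enumerates (λ u → not (P u) ∨ not (dot u w)) p u) Pu)

perpP-linear : ∀ P → F₂⁴.Linear (perpP P)
perpP-linear P = record
  { 0∈       = ∈-perpP⁺ {P} {0v} λ u _ → dot-0ʳ u
  ; +-closed = λ {x} {y} x∈ y∈ → ∈-perpP⁺ {P} {x ⊕ y} λ u Pu →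
      trans (dot-⊕ʳ u x y) (cong₂ _xor_ (∈-perpP⁻ {P} x∈ {u} Pu) (∈-perpP⁻ {P} y∈ {u} Pu))
  }

_^⊥ : Subspace → V₂ 4 → Bool
U ^⊥ = perpP (_∈ˢ U)

∈-⊥-+ˢ : ∀ A B {w} → T ((A ^⊥) w) → T ((B ^⊥) w) → T (((A +ˢ B) ^⊥) w)
∈-⊥-+ˢ A B {w} w∈A⊥ w∈B⊥ = ∈-perpP⁺ {_∈ˢ (A +ˢ B)} {w} λ x x∈A+B →
  x⊥w x (sumP-elim A B (∈-subspace⁻ (sumP-linear A B) {x} x∈A+B))
  where
  x⊥w : ∀ x → (∃ λ a → T (a ∈ˢ A) × T ((a ⊕ x) ∈ˢ B)) → dot x w ≡ false
  x⊥w x (a , a∈A , a+x∈B) = begin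
    dot x w                     ≡⟨ cong (λ y → dot y w) (F₂⁴.+-cancelˡ a x) ⟨
    dot (a ⊕ (a ⊕ x)) w         ≡⟨ dot-⊕ˡ a (a ⊕ x) w ⟩
    dot a w xor dot (a ⊕ x) w   ≡⟨ cong₂ _xor_ (∈-perpP⁻ {_∈ˢ A} w∈A⊥ {a} a∈A)
                                                 (∈-perpP⁻ {_∈ˢ B} w∈B⊥ {a ⊕ x} a+x∈B) ⟩
    false                       ∎
    where open ≡-Reasoning

Eˢ⊥≡0 : ∀ w → T ((Eˢ ^⊥) w) → w ≡ 0v
Eˢ⊥≡0 w w∈E⊥ =
  eqV-sound w 0v (⇒-elim {(Eˢ ^⊥) w} (all-elim F₂⁴.enumerates (λ w → not ((Eˢ ^⊥) w) ∨ eqV w 0v) tt w) w∈E⊥)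

-- The 35 planes of F₂⁴

combinations : {A : Set} → ℕ → List A → List (List A)
combinations zero    xs       = [] ∷ []
combinations (suc k) []       = []
combinations (suc k) (x ∷ xs) = List.map (x ∷_) (combinations k xs) ++ combinations (suc k) xs

module _ {A : Set} where

  combinations-∷ : ∀ k (x : A) {xs ys} → ys ∈ combinations k xs → ys ∈ combinations k (x ∷ xs)
  combinations-∷ zero    x ys∈ = ys∈
  combinations-∷ (suc k) x ys∈ = ∈-++⁺ʳ _ ys∈

  filter∈combinations : (P : A → Bool) (xs : List A) →
                        List.filterᵇ P xs ∈ combinations (length (List.filterᵇ P xs)) xs
  filter∈combinations P []       = here refl
  filter∈combinations P (x ∷ xs) with P x
  ... | true  = ∈-++⁺ˡ (∈-map⁺ (x ∷_) (filter∈combinations P xs))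
  ... | false = combinations-∷ (length (List.filterᵇ P xs)) x (filter∈combinations P xs)

listMember : List (V₂ 4) → V₂ 4 → Bool
listMember xs v = any (eqV v) xs

listMember-filter : ∀ (P : V₂ 4 → Bool) v → listMember (List.filterᵇ P E₄) v ≡ P v
listMember-filter P v = T-⇔⇒≡ to from
  where
  to : T (listMember (List.filterᵇ P E₄) v) → T (P v)
  to p with find (any⁻ (eqV v) (List.filterᵇ P E₄) p)
  ... | u , u∈ , v≡u = subst (T ∘ P) (sym (eqV-sound v u v≡u)) (proj₂ (∈-filter⁻ (T? ∘ P) {xs = E₄} u∈))
  from : T (P v) → T (listMember (List.filterᵇ P E₄) v)
  from Pv = any⁺ (eqV v) (lose (∈-filter⁺ (T? ∘ P) (F₂⁴.enumerates v) Pv) (eqV-refl v))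

subspace? : Tree 4 → Maybe Subspace
subspace? t = Maybe.map (sub t) (dec⇒maybe (T? (isSubspace (mem t))))

subspace?-carrier : ∀ S → subspace? (carrier S) ≡ just S
subspace?-carrier (sub t lin) = byDecision (T? (isSubspace (mem t)))
  where
  byDecision : (d : Dec (T (isSubspace (mem t)))) → Maybe.map (sub t) (dec⇒maybe d) ≡ just (sub t lin)
  byDecision (yes lin′) = cong (just ∘ sub t) (T-irrelevant lin′ lin)
  byDecision (no ¬lin)  = ⊥-elim (¬lin lin)

planes : List Subspace
planes = List.mapMaybe (subspace? ∘ toTree ∘ listMember) (combinations 4 E₄)

length-planes : length planes ≡ 35
length-planes = refl

dim≡2⇒∈planes : ∀ S → dim S ≡ 2 → S ∈ planes
dim≡2⇒∈planes S dimS≡2 = mapMaybe⁺ plane? {P = S ≡_} (combinations 4 E₄)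
  (lose {P = MaybeAny.Any (S ≡_)} (∈-map⁺ plane? {x = elems} {xs = combinations 4 E₄} elems∈)
        (subst (MaybeAny.Any (S ≡_)) (sym tree≡) (MaybeAny.just refl)))
  where
  plane? : List (V₂ 4) → Maybe Subspace
  plane? = subspace? ∘ toTree ∘ listMember
  elems : List (V₂ 4)
  elems = List.filterᵇ (_∈ˢ S) E₄
  |elems|≡4 : length elems ≡ 4
  |elems|≡4 = trans (count-∈ˢ S) (cong (2 ^_) dimS≡2)
  elems∈ : elems ∈ combinations 4 E₄
  elems∈ = subst (λ k → elems ∈ combinations k E₄) |elems|≡4 (filter∈combinations (_∈ˢ S) E₄)
  carrier≡ : toTree (listMember elems) ≡ carrier S
  carrier≡ = trans (toTree-cong (listMember-filter (_∈ˢ S))) (toTree-mem (carrier S))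
  tree≡ : plane? elems ≡ just S
  tree≡ = trans (cong subspace? carrier≡) (subspace?-carrier S)

∈planes⇒dim≡2 : ∀ {S} → S ∈ planes → dim S ≡ 2
∈planes⇒dim≡2 S∈ = ℕ.≡ᵇ⇒≡ _ 2 (All.lookup (all⁺ (λ P → dim P ℕ.≡ᵇ 2) planes tt) S∈)

plane : Fin (length planes) → Subspace
plane = List.lookup planes

-- q-matroids of rank 2 with 34 bases

injection-misses-at-most-one : ∀ {m n} → m ≡ suc n → (f : Fin n → Fin m) → (∀ {i j} → f i ≡ f j → i ≡ j) →
                               ∀ {a b} → (∀ i → f i ≢ a) → (∀ i → f i ≢ b) → a ≡ b
injection-misses-at-most-one {n = zero}  refl f f-inj {Fin.zero} {Fin.zero} _ _ = refl
injection-misses-at-most-one {n = suc n} refl f f-inj {a} {b} a∉f b∉f with a Fin.≟ b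
... | yes a≡b = a≡b
... | no  a≢b = ⊥-elim (noCollision (pigeonhole (ℕ.n<1+n n) h))
  where
  a≢f : ∀ i → a ≢ f i
  a≢f i = a∉f i ∘ sym
  b′ : Fin (suc n)
  b′ = Fin.punchOut a≢b
  b′≢g : ∀ i → b′ ≢ Fin.punchOut (a≢f i)
  b′≢g i b′≡g = b∉f i (sym (punchOut-injective a≢b (a≢f i) b′≡g))
  h : Fin (suc n) → Fin n
  h i = Fin.punchOut (b′≢g i)
  noCollision : (∃ λ i → ∃ λ j → i Fin.< j × h i ≡ h j) → ⊥
  noCollision (i , j , i<j , hi≡hj) = ℕ.<⇒≢ i<j (cong Fin.toℕ
    (f-inj (punchOut-injective (a≢f i) (a≢f j) (punchOut-injective (b′≢g i) (b′≢g j) hi≡hj))))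

module _ (M : QMatroid) where

  basis-dim≡2 : rank M ≡ + 2 → (B : Basis M) → dim (proj₁ B) ≡ 2
  basis-dim≡2 rank≡2 (B , ρ≡dim , ρ≡rank) = ℤ.+-injective (trans (sym ρ≡dim) (trans ρ≡rank rank≡2))

  basis-≡ : (B B′ : Basis M) → proj₁ B ≡ proj₁ B′ → B ≡ B′
  basis-≡ (B , p , q) (.B , p′ , q′) refl = cong₂ (λ x y → B , x , y) (uip p p′) (uip q q′)
    where uip = Decidable⇒UIP.≡-irrelevant ℤ._≟_

  Rank2PlanesExcept : Subspace → Set
  Rank2PlanesExcept P₀ = ∀ S → dim S ≡ 2 → S ≢ P₀ → ρ M S ≡ + 2

  module _ (rank≡2 : rank M ≡ + 2) (bases : Fin 34 ↔ Basis M) where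
    open Inverse bases using (to; strictlyInverseʳ)

    private
      basisPlane : Fin 34 → Fin (length planes)
      basisPlane i = Any.index (dim≡2⇒∈planes (proj₁ (to i)) (basis-dim≡2 rank≡2 (to i)))

      basisPlane-correct : ∀ i → proj₁ (to i) ≡ plane (basisPlane i)
      basisPlane-correct i = lookup-index (dim≡2⇒∈planes (proj₁ (to i)) (basis-dim≡2 rank≡2 (to i)))

      basisPlane-injective : ∀ {i j} → basisPlane i ≡ basisPlane j → i ≡ j
      basisPlane-injective {i} {j} eq = begin
        i              ≡⟨ strictlyInverseʳ i ⟨
        from (to i)    ≡⟨ cong from (basis-≡ (to i) (to j) to-i≡to-j) ⟩
        from (to j)    ≡⟨ strictlyInverseʳ j ⟩
        j              ∎
        where
        open ≡-Reasoning
        open Inverse bases using (from)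
        to-i≡to-j : proj₁ (to i) ≡ proj₁ (to j)
        to-i≡to-j = trans (basisPlane-correct i) (trans (cong plane eq) (sym (basisPlane-correct j)))

    nonBasisPlane-unique : ∀ {k₁ k₂} → ρ M (plane k₁) ≢ + 2 → ρ M (plane k₂) ≢ + 2 → k₁ ≡ k₂
    nonBasisPlane-unique ρ₁≢2 ρ₂≢2 =
      injection-misses-at-most-one length-planes basisPlane basisPlane-injective (missed ρ₁≢2) (missed ρ₂≢2)
      where
      missed : ∀ {k} → ρ M (plane k) ≢ + 2 → ∀ i → basisPlane i ≢ k
      missed ρ≢2 i refl =
        ρ≢2 (subst (λ P → ρ M P ≡ + 2) (basisPlane-correct i) (trans (proj₂ (proj₂ (to i))) rank≡2))

    private
      ρ≡2-unless : ∀ S → dim S ≡ 2 → (∀ k → ρ M (plane k) ≢ + 2 → S ≡ plane k → ⊥) → ρ M S ≡ + 2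
      ρ≡2-unless S dimS≡2 noBadPlane = decidable-stable (ρ M S ℤ.≟ + 2) λ ρ≢2 →
        noBadPlane k (ρ≢2 ∘ subst (λ P → ρ M P ≡ + 2) (sym S≡k)) S≡k
        where
        S∈ = dim≡2⇒∈planes S dimS≡2
        k = Any.index S∈
        S≡k = lookup-index S∈

    exceptionalPlane : Σ Subspace λ P₀ → dim P₀ ≡ 2 × Rank2PlanesExcept P₀
    exceptionalPlane = fromDecision (Fin.any? (λ k → ¬? (ρ M (plane k) ℤ.≟ + 2)))
      where
      fromDecision : Dec (∃ λ k → ρ M (plane k) ≢ + 2) → Σ Subspace λ P₀ → dim P₀ ≡ 2 × Rank2PlanesExcept P₀
      fromDecision (yes (k₀ , ρ₀≢2)) = plane k₀ , ∈planes⇒dim≡2 {plane k₀} (∈-lookup {xs = planes} k₀) ,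
        λ S dimS≡2 S≢P₀ → ρ≡2-unless S dimS≡2 λ k ρ≢2 S≡k →
          S≢P₀ (trans S≡k (cong plane (nonBasisPlane-unique {k} {k₀} ρ≢2 ρ₀≢2)))
      fromDecision (no noBadPlane) = proj₁ (to Fin.zero) , basis-dim≡2 rank≡2 (to Fin.zero) ,
        λ S dimS≡2 _ → ρ≡2-unless S dimS≡2 λ k ρ≢2 _ → noBadPlane (k , ρ≢2)

-- Ranks of lines

ρ-+ˢ : (M : QMatroid) (A B : Subspace) → ρ M (A +ˢ B) ℤ.≤ ρ M A ℤ.+ ρ M B
ρ-+ˢ M A B = ℤ.≤-trans (ℤ.i≤i+j (ρ M (A +ˢ B)) (ρ M (A ∩ˢ B)) {{ℤ.nonNegative (ρ-nonneg M (A ∩ˢ B))}})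
                       (ρ-submod M A B (A +ˢ B) (A ∩ˢ B) refl refl)

squeeze : ∀ {a b} → + 0 ℤ.≤ a → a ℤ.≤ + 1 → b ℤ.≤ + 1 → + 2 ℤ.≤ a ℤ.+ b → a ≡ + 1
squeeze {+ 0}           _ _                b≤1 2≤a+b with ℤ.≤-trans (subst (+ 2 ℤ.≤_) (ℤ.+-identityˡ _) 2≤a+b) b≤1
... | ℤ.+≤+ (s≤s ())
squeeze {+ 1}           _ _                _   _     = refl
squeeze {+ suc (suc n)} _ (ℤ.+≤+ (s≤s ())) _   _

e₁ e₂ : V₂ 4
e₁ = true ∷ false ∷ false ∷ false ∷ []
e₂ = false ∷ true ∷ false ∷ false ∷ []

e₁≢e₂ : e₁ ≢ e₂
e₁≢e₂ ()

e₁≢0 : e₁ ≢ 0v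
e₁≢0 ()

e₂≢0 : e₂ ≢ 0v
e₂≢0 ()

module _ (M : QMatroid) {P₀ : Subspace} (ρ-plane : Rank2PlanesExcept M P₀) where

  ρ-line+ˢline : ∀ {u v} → u ≢ 0v → v ≢ 0v → u ≢ v → ¬ T (u ∈ˢ P₀) → ρ M (line u +ˢ line v) ≡ + 2
  ρ-line+ˢline {u} {v} u≢0 v≢0 u≢v u∉P₀ = ρ-plane (line u +ˢ line v) (dim-line+ˢline u≢0 v≢0 u≢v)
    λ sum≡P₀ → u∉P₀ (subst (λ P → T (u ∈ˢ P)) sum≡P₀ (∈-+ˢˡ (line u) (line v) {u} (v∈line u)))

  private
    ρ-line≤1 : ∀ {v} → v ≢ 0v → ρ M (line v) ℤ.≤ + 1
    ρ-line≤1 {v} v≢0 = subst (λ d → ρ M (line v) ℤ.≤ + d) (dim-line v v≢0) (ρ-≤dim M (line v))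

    ρ-line≡1-via : ∀ {u v} → u ≢ 0v → v ≢ 0v → u ≢ v → ¬ T (u ∈ˢ P₀) → ρ M (line u) ≡ + 1
    ρ-line≡1-via {u} {v} u≢0 v≢0 u≢v u∉P₀ = squeeze (ρ-nonneg M (line u)) (ρ-line≤1 u≢0) (ρ-line≤1 v≢0)
      (subst (ℤ._≤ ρ M (line u) ℤ.+ ρ M (line v)) (ρ-line+ˢline u≢0 v≢0 u≢v u∉P₀) (ρ-+ˢ M (line u) (line v)))

  -- Any nonzero partner v ≠ u will do; one of e₁, e₂ always qualifies.
  ρ-line≡1 : ∀ {u} → u ≢ 0v → ¬ T (u ∈ˢ P₀) → ρ M (line u) ≡ + 1
  ρ-line≡1 {u} u≢0 u∉P₀ = withPartner (Vec.≡-dec Bool._≟_ u e₁)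
    where
    withPartner : Dec (u ≡ e₁) → ρ M (line u) ≡ + 1
    withPartner (yes u≡e₁) = ρ-line≡1-via {v = e₂} u≢0 e₂≢0 (λ u≡e₂ → e₁≢e₂ (trans (sym u≡e₁) u≡e₂)) u∉P₀
    withPartner (no  u≢e₁) = ρ-line≡1-via {v = e₁} u≢0 e₁≢0 u≢e₁ u∉P₀

⊆ᵖ-intro : ∀ {P Q : V₂ 4 → Bool} → (∀ v → T (P v) → T (Q v)) → T (P ⊆ᵖ Q)
⊆ᵖ-intro {P} {Q} P⊆Q = all-intro (λ v → not (P v) ∨ Q v) {E₄} λ v → ⇒-intro {P v} (P⊆Q v)

⊆ᵖ-elim : ∀ {P Q : V₂ 4 → Bool} → T (P ⊆ᵖ Q) → ∀ v → T (P v) → T (Q v)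
⊆ᵖ-elim {P} {Q} P⊆Q v = ⇒-elim {P v} (all-elim F₂⁴.enumerates (λ v → not (P v) ∨ Q v) P⊆Q v)

unit : ∀ {m} → Fin m → V₂ m
unit {suc m} Fin.zero    = true ∷ replicate m false
unit {suc m} (Fin.suc i) = false ∷ unit i

lincomb-0 : ∀ {m} (M : Mat m) → lincomb (replicate m false) M ≡ 0v
lincomb-0 []           = refl
lincomb-0 (col ∷ cols) = trans (F₂⁴.+-identityˡ _) (lincomb-0 cols)

lincomb-unit : ∀ {m} (i : Fin m) (M : Mat m) → lincomb (unit i) M ≡ Vec.lookup M i
lincomb-unit Fin.zero    (col ∷ cols) = trans (cong (col ⊕_) (lincomb-0 cols)) (F₂⁴.+-identityʳ col)
lincomb-unit (Fin.suc i) (col ∷ cols) = trans (F₂⁴.+-identityˡ _) (lincomb-unit i cols)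

lincomb∈colsp : ∀ {m} (c : V₂ m) (M : Mat m) → T (colsp M (lincomb c M))
lincomb∈colsp {m} c M =
  any-intro (F₂Space.enumerates (vectors 𝔽₂ m)) (λ c′ → eqV (lincomb c′ M) (lincomb c M)) {c} (eqV-refl (lincomb c M))

colsp⁻ : ∀ {m} {M : Mat m} {v} → T (colsp M v) → ∃ λ c → lincomb c M ≡ v
colsp⁻ {m} {M} {v} v∈ with any-elim (λ c → eqV (lincomb c M) v) {allV m} v∈
... | c , eq = c , eqV-sound _ v eq

lincomb-∈ : ∀ {W} → F₂⁴.Linear W → ∀ {m} {M : Mat m} → VecAll.All (T ∘ W) M → ∀ c → T (W (lincomb c M))
lincomb-∈ linW VecAll.[]               []            = F₂⁴.Linear.0∈ linW
lincomb-∈ {W} linW (col∈W VecAll.∷ cols∈W) (c ∷ cs) =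
  F₂⁴.Linear.+-closed linW {if c then _ else 0v} (head∈ c) (lincomb-∈ linW cols∈W cs)
  where
  head∈ : ∀ c → T (W (if c then _ else 0v))
  head∈ true  = col∈W
  head∈ false = F₂⁴.Linear.0∈ linW

colsp⊆⇒columns : ∀ {W} {m} (M : Mat m) → T (colsp M ⊆ᵖ W) → VecAll.All (T ∘ W) M
colsp⊆⇒columns {W} M M⊆W = VecAll.lookup⁻ λ i → ⊆ᵖ-elim {colsp M} {W} M⊆W (Vec.lookup M i)
  (subst (T ∘ colsp M) (lincomb-unit i M) (lincomb∈colsp (unit i) M))

columns⇒colsp⊆ : ∀ {W} → F₂⁴.Linear W → ∀ {m} {M : Mat m} → VecAll.All (T ∘ W) M → T (colsp M ⊆ᵖ W)
columns⇒colsp⊆ {W} linW {M = M} cols∈W = ⊆ᵖ-intro {colsp M} {W} λ v v∈ →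
  let c , Mc≡v = colsp⁻ {M = M} v∈ in subst (T ∘ W) Mc≡v (lincomb-∈ linW cols∈W c)

module _ {m : ℕ} {C : Mat m → Bool} (linC : Matrices.Linear m C) where
  open F₂⁴.Linear
  open Matrices.Linear m renaming (0∈ to 0∈ᴹ; +-closed to +-closedᴹ)

  restrictMat-linear : ∀ {W} → F₂⁴.Linear W → Matrices.Linear m (restrictMat C W)
  restrictMat-linear {W} linW = record { 0∈ = 0∈-restrict ; +-closed = λ {M} {N} → closed {M} {N} }
    where
    0∈-restrict : T (restrictMat C W (replicate m 0v))
    0∈-restrict = ∧-intro {C (replicate m 0v)} (0∈ᴹ linC) (columns⇒colsp⊆ linW {M = replicate m 0v}
      (VecAll.lookup⁻ λ i → subst (T ∘ W) (sym (Vec.lookup-replicate i 0v)) (0∈ linW)))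
    closed : ∀ {M N} → T (restrictMat C W M) → T (restrictMat C W N) → T (restrictMat C W (zipWith _⊕_ M N))
    closed {M} {N} M∈ N∈ = ∧-intro {C (zipWith _⊕_ M N)}
      (+-closedᴹ linC {M} {N} (∧-elimˡ {C M} M∈) (∧-elimˡ {C N} N∈))
      (columns⇒colsp⊆ linW {M = zipWith _⊕_ M N} (VecAll.zipWith (λ {x} {y} → +-closed linW {x} {y})
        (colsp⊆⇒columns M (∧-elimʳ {C M} M∈)) (colsp⊆⇒columns N (∧-elimʳ {C N} N∈))))

  restrictMat-∩ : ∀ {W₁ W₂ W} → F₂⁴.Linear W → (∀ v → T (W₁ v) → T (W₂ v) → T (W v)) →
                  ∀ M → T (restrictMat C W₁ M) → T (restrictMat C W₂ M) → T (restrictMat C W M)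
  restrictMat-∩ {W₁} {W₂} {W} linW W₁∩W₂⊆W M M∈₁ M∈₂ = ∧-intro {C M} (∧-elimˡ {C M} M∈₁)
    (columns⇒colsp⊆ linW {M = M} (VecAll.map (λ {v} (v∈₁ , v∈₂) → W₁∩W₂⊆W v v∈₁ v∈₂)
      (VecAll.zip (colsp⊆⇒columns M (∧-elimʳ {C M} M∈₁) , colsp⊆⇒columns M (∧-elimʳ {C M} M∈₂)))))

  restrictMat-zero : ∀ {W} → (∀ v → T (W v) → v ≡ 0v) → ∀ M → T (restrictMat C W M) → T (Matrices.isZero m M)
  restrictMat-zero {W} W≡0 M M∈ =
    subst (T ∘ Matrices.isZero m) (sym (columns≡0 (colsp⊆⇒columns M (∧-elimʳ {C M} M∈)))) (Matrices.isZero-0# m)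
    where
    columns≡0 : ∀ {k} {N : Mat k} → VecAll.All (T ∘ W) N → N ≡ replicate k 0v
    columns≡0 VecAll.[]             = refl
    columns≡0 (col∈W VecAll.∷ cols) = cong₂ _∷_ (W≡0 _ col∈W) (columns≡0 cols)

-- Matrix representations

+m*r≡+a-+b⇒a≡m*r+b : ∀ {m r a b} → + m ℤ.* + r ≡ + a ℤ.- + b → a ≡ m ℕ.* r ℕ.+ b
+m*r≡+a-+b⇒a≡m*r+b {m} {r} {a} {b} eq = ℤ.+-injective (begin
  + a                           ≡⟨ ℤ.+-identityʳ (+ a) ⟨
  + a ℤ.+ + 0                   ≡⟨ cong (λ z → + a ℤ.+ z) (ℤ.+-inverseˡ (+ b)) ⟨
  + a ℤ.+ (ℤ.- + b ℤ.+ + b)     ≡⟨ ℤ.+-assoc (+ a) (ℤ.- + b) (+ b) ⟨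
  (+ a ℤ.- + b) ℤ.+ + b         ≡⟨ cong (ℤ._+ + b) eq ⟨
  + m ℤ.* + r ℤ.+ + b           ≡⟨ cong (ℤ._+ + b) (ℤ.pos-* m r) ⟨
  + (m ℕ.* r ℕ.+ b)             ∎)
  where open ≡-Reasoning

module _ (M : QMatroid) (rank≡2 : rank M ≡ + 2) {P₀ : Subspace} (dimP₀≡2 : dim P₀ ≡ 2)
         (ρ-plane : Rank2PlanesExcept M P₀) where

  -- Any two of these span a plane other than P₀.
  outside : List (V₂ 4)
  outside = List.filterᵇ (λ v → not (v ∈ˢ P₀)) E₄

  length-outside : length outside ≡ 12
  length-outside = ℕ.+-cancelˡ-≡ 4 _ _ (begin
    4 ℕ.+ length outside                  ≡⟨ cong (ℕ._+ length outside) (trans (count-∈ˢ P₀) (cong (2 ^_) dimP₀≡2)) ⟨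
    count E₄ (_∈ˢ P₀) ℕ.+ length outside  ≡⟨ count+count-not E₄ (_∈ˢ P₀) ⟩
    16                                    ∎)
    where open ≡-Reasoning

  private
    outside-∉P₀ : All (λ u → ¬ T (u ∈ˢ P₀)) outside
    outside-∉P₀ = All.map (λ {u} → T-not⇒¬T {u ∈ˢ P₀}) (all-filter (T? ∘ λ v → not (v ∈ˢ P₀)) E₄)

    outside-unique : Unique outside
    outside-unique = Unique.filter⁺ (T? ∘ λ v → not (v ∈ˢ P₀)) E₄-unique

    ∉P₀⇒≢0 : ∀ {u} → ¬ T (u ∈ˢ P₀) → u ≢ 0v
    ∉P₀⇒≢0 {u} u∉P₀ u≡0 = u∉P₀ (subst (T ∘ (_∈ˢ P₀)) (sym u≡0) (F₂⁴.Linear.0∈ (∈ˢ-linear P₀)))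

  module _ {m} (representation : MatrixRepresentable m (ρ M)) where
    private
      module Ms = Matrices m
      Ms = allMats m
      C = proj₁ representation
      linC = Ms.isLinear⇒Linear {C} (proj₁ (proj₂ representation))
      ρ≡ = proj₂ (proj₂ representation)

    𝒦 : Subspace → Mat m → Bool
    𝒦 U = restrictMat C (U ^⊥)

    dim-C : ∀ U {r} → ρ M U ≡ + r → dim₂ Ms C ≡ m ℕ.* r ℕ.+ dim₂ Ms (𝒦 U)
    dim-C U {r} ρ≡r = +m*r≡+a-+b⇒a≡m*r+b {m} {r} (trans (cong (λ x → + m ℤ.* x) (sym ρ≡r)) (ρ≡ U))

    count-𝒦 : ∀ U → count Ms (𝒦 U) ≡ 2 ^ dim₂ Ms (𝒦 U)
    count-𝒦 U = Ms.linear⇒count≡2^dim {𝒦 U} (restrictMat-linear linC {U ^⊥} (perpP-linear (_∈ˢ U)))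

    dim-C≡ : dim₂ Ms C ≡ m ℕ.* 2
    dim-C≡ = trans (dim-C Eˢ rank≡2) (trans (cong (m ℕ.* 2 ℕ.+_) dim𝒦E≡0) (ℕ.+-identityʳ _))
      where
      dim𝒦E≡0 : dim₂ Ms (𝒦 Eˢ) ≡ 0
      dim𝒦E≡0 = ℕ.n≤0⇒n≡0 (⌊log₂⌋-mono-≤ (ℕ.≤-trans (count-mono Ms {𝒦 Eˢ} (restrictMat-zero linC {Eˢ ^⊥} Eˢ⊥≡0))
                                                    (ℕ.≤-reflexive Ms.count-isZero)))

    count-C : count Ms C ≡ 2 ^ (m ℕ.* 2)
    count-C = trans (Ms.linear⇒count≡2^dim {C} linC) (cong (2 ^_) dim-C≡)

    count-𝒦line : ∀ {u} → ¬ T (u ∈ˢ P₀) → count Ms (𝒦 (line u)) ≡ 2 ^ m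
    count-𝒦line {u} u∉P₀ = trans (count-𝒦 (line u)) (cong (2 ^_) (ℕ.+-cancelˡ-≡ m _ _ (begin
      m ℕ.+ dim₂ Ms (𝒦 (line u))        ≡⟨ cong (ℕ._+ dim₂ Ms (𝒦 (line u))) (ℕ.*-identityʳ m) ⟨
      m ℕ.* 1 ℕ.+ dim₂ Ms (𝒦 (line u))  ≡⟨ dim-C (line u) (ρ-line≡1 M {P₀} ρ-plane {u} (∉P₀⇒≢0 u∉P₀) u∉P₀) ⟨
      dim₂ Ms C                         ≡⟨ dim-C≡ ⟩
      m ℕ.* 2                           ≡⟨ ℕ.*-suc m 1 ⟩
      m ℕ.+ m ℕ.* 1                     ≡⟨ cong (m ℕ.+_) (ℕ.*-identityʳ m) ⟩
      m ℕ.+ m                           ∎)))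
      where open ≡-Reasoning

    𝒦-rank2⊆0 : ∀ S → ρ M S ≡ + 2 → ∀ x → T (𝒦 S x) → T (Ms.isZero x)
    𝒦-rank2⊆0 S ρS≡2 x = count-≤⇒⊇ Ms (Ms.isZero⊆ 𝒦S-linear) |𝒦S|≤1 (Ms.enumerates x)
      where
      𝒦S-linear = restrictMat-linear linC (perpP-linear (_∈ˢ S))
      dim𝒦S≡0 : dim₂ Ms (𝒦 S) ≡ 0
      dim𝒦S≡0 =
        ℕ.+-cancelˡ-≡ (m ℕ.* 2) _ _ (trans (sym (dim-C S ρS≡2)) (trans dim-C≡ (sym (ℕ.+-identityʳ _))))
      |𝒦S|≤1 : count Ms (𝒦 S) ≤ count Ms Ms.isZero
      |𝒦S|≤1 = ℕ.≤-reflexive (trans (count-𝒦 S) (trans (cong (2 ^_) dim𝒦S≡0) (sym Ms.count-isZero)))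

    𝒦-meet : ∀ {u v} → ¬ T (u ∈ˢ P₀) → ¬ T (v ∈ˢ P₀) → u ≢ v → MeetInZ Ms Ms.isZero (𝒦 ∘ line) u v
    𝒦-meet {u} {v} u∉P₀ v∉P₀ u≢v x x∈𝒦u x∈𝒦v = 𝒦-rank2⊆0 (line u +ˢ line v) ρ≡2 x x∈𝒦[u+v]
      where
      ρ≡2 = ρ-line+ˢline M {P₀} ρ-plane {u} {v} (∉P₀⇒≢0 u∉P₀) (∉P₀⇒≢0 v∉P₀) u≢v u∉P₀
      x∈𝒦[u+v] = restrictMat-∩ linC {line u ^⊥} {line v ^⊥} {(line u +ˢ line v) ^⊥}
        (perpP-linear (_∈ˢ (line u +ˢ line v))) (λ w → ∈-⊥-+ˢ (line u) (line v) {w}) x x∈𝒦u x∈𝒦v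

    matrixRepresentable⇒bound : 1 ℕ.+ 12 ℕ.* 2 ^ m ≤ 2 ^ (m ℕ.* 2) ℕ.+ 12
    matrixRepresentable⇒bound = begin
      1 ℕ.+ 12 ℕ.* 2 ^ m               ≡⟨ cong₂ (λ z r → z ℕ.+ r ℕ.* 2 ^ m) Ms.count-isZero length-outside ⟨
      |0| ℕ.+ length outside ℕ.* 2 ^ m  ≤⟨ count-⋃ Ms Ms.isZero (𝒦 ∘ line) large pairs ⟩
      |⋃| ℕ.+ length outside ℕ.* |0|    ≤⟨ ℕ.+-monoˡ-≤ _ |⋃|≤|C| ⟩
      |C| ℕ.+ length outside ℕ.* |0|    ≡⟨ cong₂ (λ c r → c ℕ.+ r ℕ.* |0|) count-C length-outside ⟩
      2 ^ (m ℕ.* 2) ℕ.+ 12 ℕ.* |0|      ≡⟨ cong (λ z → 2 ^ (m ℕ.* 2) ℕ.+ 12 ℕ.* z) Ms.count-isZero ⟩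
      2 ^ (m ℕ.* 2) ℕ.+ 12              ∎
      where
      open ℕ.≤-Reasoning
      |0| = count Ms Ms.isZero
      |⋃| = count Ms (⋃ Ms Ms.isZero (𝒦 ∘ line) outside)
      |C| = count Ms C
      large : All (λ u → 2 ^ m ≤ count Ms (𝒦 (line u))) outside
      large = All.map (λ {u} u∉P₀ → ℕ.≤-reflexive (sym (count-𝒦line {u} u∉P₀))) outside-∉P₀
      pairs : AllPairs (MeetInZ Ms Ms.isZero (𝒦 ∘ line)) outside
      pairs = allPairs-with outside-∉P₀ outside-unique 𝒦-meet
      |⋃|≤|C| : |⋃| ≤ |C|
      |⋃|≤|C| = count-mono Ms (⋃-⊆ Ms Ms.isZero (𝒦 ∘ line) (Ms.isZero⊆ linC) (λ u x x∈ → ∧-elimˡ {C x} x∈) outside)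

bound-fails : ∀ {m} → m ≡ 2 ⊎ m ≡ 3 → ¬ (1 ℕ.+ 12 ℕ.* 2 ^ m ≤ 2 ^ (m ℕ.* 2) ℕ.+ 12)
bound-fails (inj₁ refl) = toWitnessFalse {a? = _ ℕ.≤? _} tt
bound-fails (inj₂ refl) = toWitnessFalse {a? = _ ℕ.≤? _} tt

proposition6p5 : (M : QMatroid) → rank M ≡ + 2 → Fin 34 ↔ Basis M
    → (m : ℕ) → m ≡ 2 ⊎ m ≡ 3 → ¬ PurelyMultilinear m M
proposition6p5 M rank≡2 bases m m∈23 (representation , _) =
  let _ , dimP₀≡2 , ρ-plane = exceptionalPlane M rank≡2 bases
  in  bound-fails m∈23 (matrixRepresentable⇒bound M rank≡2 dimP₀≡2 ρ-plane representation)
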